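{- Let $q\ge 2$ and $n\ge 1$ be integers, and let $S=(s_i)$ be a negative orientable sequence of order $n$ over $\mathbb{Z}_q$ with period $m$. Let $h$ be the additive order of $w_q(S)$ in $\mathbb{Z}_q$. Then there are $q/h$ sequences $T_1,\dots,T_{q/h}$, each an orientable sequence of order $n+1$ with period $hm$, which are translates of one another and pairwise o-disjoint, such that $D^{ -1}(S)$ consists exactly of the $h$ shifts $(t_{i+km})_i$, $0\le k\le h-1$, of each $T_\ell=(t_i)$.
   Context: Sequences are periodic with entries in $\mathbb{Z}_q$; the period means the least period. For $S=(s_i)$ of period $m$, $\mathbf{s}_n(i)=(s_i,\dots,s_{i+n-1})$; the ring sequence is $[s_0,\dots,s_{m-1}]$ and $w_q(S)=\sum_{i=0}^{m-1}s_i \bmod q$. For a tuple $\mathbf{u}=(u_0,\dots,u_{n-1})$, $\mathbf{u}^R=(u_{n-1},\dots,u_0)$ and $-\mathbf{u}=(-u_0,\dots,-u_{n-1})$. $S$ is an $n$-window sequence if $\mathbf{s}_n(i)=\mathbf{s}_n(j)$ implies $i\equiv j\pmod m$. An orientable sequence of order $n$ is an $n$-window sequence with $\mathbf{s}_n(i)\neq\mathbf{s}_n(j)^R$ for all $i,j$; a negative orientable sequence of order $n$ is an $n$-window sequence with $\mathbf{s}_n(i)\neq-\mathbf{s}_n(j)^R$ for all $i,j$. Two $n$-window sequences $S,S'$ are disjoint if $\mathbf{s}_n(i)\neq\mathbf{s}'_n(j)$ for all $i,j$, and o-disjoint if they are disjoint and $\mathbf{s}_n(i)\neq\mathbf{s}'_n(j)^R$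 for all $i,j$. A translate of $(t_i)$ is $(t_i+\lambda)$ for nonzero $\lambda\in\mathbb{Z}_q$; a shift is $(t_{i+k})$. $D$ maps $(t_i)$ to $(t_{i+1}-t_i)$, and $D^{ -1}(S)$ is the set of all periodic sequences $T$ with $D(T)=S$. -}

module Defs where

open import Data.Nat using (ℕ; zero; suc; _+_; _*_; _∸_; _≤_; _<_; NonZero)
open import Data.Nat.DivMod using (_mod_)
open import Data.Nat.Divisibility using (_∣_)
open import Data.Fin using (Fin; toℕ)
open import Data.Vec using (Vec; tabulate; reverse; map)
open import Data.Product using (Σ; ∃; _×_)
open import Data.Sum using (_⊎_)
open import Relation.Binary.PropositionalEquality using (_≡_; _≢_)

Seq : ℕ → Set
Seq q = ℕ → Fin q

module _ {q : ℕ} .{{_ : NonZero q}} where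

  _+q_ : Fin q → Fin q → Fin q
  a +q b = (toℕ a + toℕ b) mod q

  negq : Fin q → Fin q
  negq a = (q ∸ toℕ a) mod q

  _-q_ : Fin q → Fin q → Fin q
  a -q b = a +q negq b

  0q : Fin q
  0q = 0 mod q

  wq : Seq q → ℕ → Fin q
  wq s m = sumℕ m mod q
    where
    sumℕ : ℕ → ℕ
    sumℕ zero = 0
    sumℕ (suc k) = sumℕ k + toℕ (s k)

  AddOrder : Fin q → ℕ → Set
  AddOrder w h = 1 ≤ h × q ∣ h * toℕ w × (∀ h' → 1 ≤ h' → q ∣ h' * toℕ w → h ≤ h')

  D : Seq q → Seq q
  D t i = t (suc i) -q t i

  negV : ∀ {n} → Vec (Fin q) n → Vec (Fin q) n
  negV = map negq

IsPeriodOf : ∀ {q} → ℕ → Seq q → Set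
IsPeriodOf p s = 1 ≤ p × (∀ i → s (i + p) ≡ s i)

Periodic : ∀ {q} → Seq q → Set
Periodic s = ∃ λ p → IsPeriodOf p s

HasPeriod : ∀ {q} → Seq q → ℕ → Set
HasPeriod s m = IsPeriodOf m s × (∀ p → IsPeriodOf p s → m ≤ p)

_≡_[mod_] : ℕ → ℕ → ℕ → Set
i ≡ j [mod m ] = ∃ λ k → (i ≡ j + k * m) ⊎ (j ≡ i + k * m)

window : ∀ {q} (n : ℕ) → Seq q → ℕ → Vec (Fin q) n
window n s i = tabulate (λ j → s (i + toℕ j))

WindowSeq : ∀ {q} → ℕ → Seq q → ℕ → Set
WindowSeq n s m = HasPeriod s m ×
  (∀ i j → window n s i ≡ window n s j → i ≡ j [mod m ])

Orientable : ∀ {q} → ℕ → Seq q → ℕ → Set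
Orientable n s m = WindowSeq n s m ×
  (∀ i j → window n s i ≢ reverse (window n s j))

NegOrientable : ∀ {q} .{{_ : NonZero q}} → ℕ → Seq q → ℕ → Set
NegOrientable n s m = WindowSeq n s m ×
  (∀ i j → window n s i ≢ negV (reverse (window n s j)))

Disjoint : ∀ {q} → ℕ → Seq q → Seq q → Set
Disjoint n s s' = ∀ i j → window n s i ≢ window n s' j

ODisjoint : ∀ {q} → ℕ → Seq q → Seq q → Set
ODisjoint n s s' = Disjoint n s s' × (∀ i j → window n s i ≢ reverse (window n s' j))

IsTranslate : ∀ {q} .{{_ : NonZero q}} → Seq q → Seq q → Set
IsTranslate {q} t' t = Σ (Fin q) λ c → c ≢ 0q × (∀ i → t' i ≡ t i +q c)

InDInv : ∀ {q} .{{_ : NonZero q}} → Seq q → Seq q → Set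
InDInv s u = Periodic u × (∀ i → D u i ≡ s i)

{-# OPTIONS --safe #-}
module Submission where

open import Algebra.Bundles using (AbelianGroup)
open import Algebra.Consequences.Propositional using (comm∧idˡ⇒id; comm∧invˡ⇒inv)
open import Data.Fin using (Fin; toℕ; fromℕ<)
open import Data.Fin.Properties using (toℕ-fromℕ<; toℕ-injective; toℕ<n)
open import Data.Nat
open import Data.Nat.DivMod
open import Data.Nat.Divisibility
open import Data.Nat.GCD using (gcd; gcd-GCD; gcd[m,n]∣m; gcd[m,n]∣n; gcd[m,n]≢0; gcd[m,n]≤n; module Bézout)
open import Data.Nat.Properties
open import Algebra.Properties.CommutativeSemigroup +-commutativeSemigroup using (xy∙z≈xz∙y; xy∙z≈x∙zy)
open import Data.Nat.Tactic.RingSolver using (solve-∀)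
open import Data.Product using (Σ; ∃; _×_; _,_; proj₁; proj₂)
open import Data.Sum using (inj₁; inj₂)
open import Data.Vec using (tabulate; reverse; lookup; head; _∷_; _∷ʳ_)
open import Data.Vec.Properties using (lookup∘tabulate; tabulate-cong; tabulate-∘; reverse-∷)
open import Function.Base using (_∘_)
open import Function.Bundles using (_⇔_; mk⇔)
open import Level using (0ℓ)
open import Relation.Binary.PropositionalEquality
open import Relation.Binary.PropositionalEquality.Algebra using (isMagma)
open import Relation.Nullary using (contradiction)

open import Defs

open ≡-Reasoning

-- Let P i = s₀ + ⋯ + s₍ᵢ₋₁₎ and w = P m. The solutions of D u = s are the sequences
-- u i = a + P i, and since s has period m, shifting such a solution by k m adds k w to it.
-- The subgroup of ℤ_q generated by w has order h and index g = gcd(w, q) = q / h, with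
-- coset representatives 0, …, g - 1. Hence the g solutions T_ℓ i = ℓ + P i (ℓ < g) are
-- translates of each other and their shifts by k m (k < h) exhaust D⁻¹(S). A window of
-- length n + 1 of a solution determines the window of length n of s at the same position,
-- and a reversed one determines the negated reversed window. So coinciding windows of two
-- solutions give coinciding windows of s, hence positions congruent modulo m, and then by
-- the coset argument the same ℓ and positions congruent modulo h m; reversed coincidences
-- are excluded by the negative orientability of S.

toℕ-mod : ∀ a n .{{_ : NonZero n}} → toℕ (a mod n) ≡ a % n
toℕ-mod a n = toℕ-fromℕ< (m%n<n a n)

-- Congruence modulo q is expressed as equality of residues a mod q in Fin q, so that the
-- group laws of (Fin q, +q) apply to it.
module Residues (q : ℕ) .{{_ : NonZero q}} where

  %≡%⇒mod≡mod : ∀ {a b} → a % q ≡ b % q → a mod q ≡ b mod q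
  %≡%⇒mod≡mod {a} {b} eq = toℕ-injective (trans (toℕ-mod a q) (trans eq (sym (toℕ-mod b q))))

  mod≡mod⇒%≡% : ∀ {a b} → a mod q ≡ b mod q → a % q ≡ b % q
  mod≡mod⇒%≡% {a} {b} eq = trans (sym (toℕ-mod a q)) (trans (cong toℕ eq) (toℕ-mod b q))

  mod-toℕ : (x : Fin q) → toℕ x mod q ≡ x
  mod-toℕ x = toℕ-injective (trans (toℕ-mod (toℕ x) q) (m<n⇒m%n≡m (toℕ<n x)))

  mod-injective : ∀ {a b} → a < q → b < q → a mod q ≡ b mod q → a ≡ b
  mod-injective a<q b<q eq =
    trans (sym (m<n⇒m%n≡m a<q)) (trans (mod≡mod⇒%≡% eq) (m<n⇒m%n≡m b<q))

  +-mod : ∀ a b → (a + b) mod q ≡ (a mod q) +q (b mod q)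
  +-mod a b = %≡%⇒mod≡mod (begin
    (a + b) % q                             ≡⟨ %-distribˡ-+ a b q ⟩
    (a % q + b % q) % q                     ≡⟨ cong₂ (λ x y → (x + y) % q) (toℕ-mod a q) (toℕ-mod b q) ⟨
    (toℕ (a mod q) + toℕ (b mod q)) % q     ∎)

  +-congˡ-mod : ∀ a {b c} → b mod q ≡ c mod q → (a + b) mod q ≡ (a + c) mod q
  +-congˡ-mod a {b} {c} eq = begin
    (a + b) mod q            ≡⟨ +-mod a b ⟩
    (a mod q) +q (b mod q)   ≡⟨ cong ((a mod q) +q_) eq ⟩
    (a mod q) +q (c mod q)   ≡⟨ +-mod a c ⟨
    (a + c) mod q            ∎

  *-congˡ-mod : ∀ k {a b} → a mod q ≡ b mod q → (k * a) mod q ≡ (k * b) mod q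
  *-congˡ-mod k {a} {b} eq = %≡%⇒mod≡mod (begin
    (k * a) % q               ≡⟨ %-distribˡ-* k a q ⟩
    (k % q * (a % q)) % q     ≡⟨ cong (λ x → (k % q * x) % q) (mod≡mod⇒%≡% eq) ⟩
    (k % q * (b % q)) % q     ≡⟨ %-distribˡ-* k b q ⟨
    (k * b) % q               ∎)

  ∣⇒mod≡0q : ∀ {a} → q ∣ a → a mod q ≡ 0q
  ∣⇒mod≡0q {a} q∣a = %≡%⇒mod≡mod (trans (n∣m⇒m%n≡0 a q q∣a) (sym (m*n%n≡0 0 q)))

  mod≡0q⇒∣ : ∀ {a} → a mod q ≡ 0q → q ∣ a
  mod≡0q⇒∣ {a} eq = m%n≡0⇒n∣m a q (trans (mod≡mod⇒%≡% eq) (m*n%n≡0 0 q))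

  +-mod-∣ˡ : ∀ {a} b → q ∣ a → (a + b) mod q ≡ b mod q
  +-mod-∣ˡ b q∣a = %≡%⇒mod≡mod (%-remove-+ˡ b q∣a)

  +-mod-∣ʳ : ∀ a {b} → q ∣ b → (a + b) mod q ≡ a mod q
  +-mod-∣ʳ a q∣b = %≡%⇒mod≡mod (%-remove-+ʳ a q∣b)

  +q-comm : ∀ x y → x +q y ≡ y +q x
  +q-comm x y = cong (_mod q) (+-comm (toℕ x) (toℕ y))

  +q-assoc : ∀ x y z → (x +q y) +q z ≡ x +q (y +q z)
  +q-assoc x y z = begin
    (x +q y) +q z                             ≡⟨ cong ((x +q y) +q_) (mod-toℕ z) ⟨
    ((toℕ x + toℕ y) mod q) +q (toℕ z mod q)  ≡⟨ +-mod (toℕ x + toℕ y) (toℕ z) ⟨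
    (toℕ x + toℕ y + toℕ z) mod q             ≡⟨ cong (_mod q) (+-assoc (toℕ x) (toℕ y) (toℕ z)) ⟩
    (toℕ x + (toℕ y + toℕ z)) mod q           ≡⟨ +-mod (toℕ x) (toℕ y + toℕ z) ⟩
    (toℕ x mod q) +q ((toℕ y + toℕ z) mod q)  ≡⟨ cong (_+q (y +q z)) (mod-toℕ x) ⟩
    x +q (y +q z)                             ∎

  +q-identityˡ : ∀ x → 0q +q x ≡ x
  +q-identityˡ x = begin
    0q +q x                     ≡⟨ cong (0q +q_) (mod-toℕ x) ⟨
    (0 mod q) +q (toℕ x mod q)  ≡⟨ +-mod 0 (toℕ x) ⟨
    toℕ x mod q                 ≡⟨ mod-toℕ x ⟩
    x                           ∎

  +q-inverseˡ : ∀ x → negq x +q x ≡ 0q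
  +q-inverseˡ x = begin
    negq x +q x                          ≡⟨ cong (negq x +q_) (mod-toℕ x) ⟨
    ((q ∸ toℕ x) mod q) +q (toℕ x mod q) ≡⟨ +-mod (q ∸ toℕ x) (toℕ x) ⟨
    (q ∸ toℕ x + toℕ x) mod q            ≡⟨ cong (_mod q) (m∸n+n≡m (<⇒≤ (toℕ<n x))) ⟩
    q mod q                              ≡⟨ ∣⇒mod≡0q ∣-refl ⟩
    0q                                   ∎

  +q-abelianGroup : AbelianGroup 0ℓ 0ℓ
  +q-abelianGroup = record
    { _∙_ = _+q_
    ; ε = 0q
    ; _⁻¹ = negq
    ; isAbelianGroup = record
      { isGroup = record
        { isMonoid = record
          { isSemigroup = record { isMagma = isMagma _+q_ ; assoc = +q-assoc }
          ; identity = comm∧idˡ⇒id +q-comm +q-identityˡ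
          }
        ; inverse = comm∧invˡ⇒inv +q-comm +q-inverseˡ
        ; ⁻¹-cong = cong negq
        }
      ; comm = +q-comm
      }
    }

  open AbelianGroup +q-abelianGroup public
    using () renaming (identityʳ to +q-identityʳ)
  open import Algebra.Properties.AbelianGroup +q-abelianGroup public
    using (∙-cancelˡ; //-rightDividesˡ; //-rightDividesʳ; ⁻¹-anti-homo‿-; x∙y⁻¹≈ε⇒x≈y)

  -q≡⇒≡+q : ∀ {x y z} → y -q x ≡ z → y ≡ x +q z
  -q≡⇒≡+q {x} {y} refl = trans (sym (//-rightDividesˡ x y)) (+q-comm (y -q x) x)

  ≡+q⇒-q≡ : ∀ {x y z} → y ≡ x +q z → y -q x ≡ z
  ≡+q⇒-q≡ {x} {z = z} refl = trans (cong (_-q x) (+q-comm x z)) (//-rightDividesʳ x z)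

  -q-anticomm : ∀ x y → x -q y ≡ negq (y -q x)
  -q-anticomm x y = sym (⁻¹-anti-homo‿- y x)

periodic-+* : ∀ {A : Set} {f : ℕ → A} {m} → (∀ i → f (i + m) ≡ f i) → ∀ i k → f (i + k * m) ≡ f i
periodic-+* {f = f} {m} _        i zero    = cong f (+-identityʳ i)
periodic-+* {f = f} {m} periodic i (suc k) = begin
  f (i + (m + k * m))  ≡⟨ cong f (+-assoc i m (k * m)) ⟨
  f (i + m + k * m)    ≡⟨ periodic-+* periodic (i + m) k ⟩
  f (i + m)            ≡⟨ periodic i ⟩
  f i                  ∎

least-period-∣ : ∀ {q} {s : Seq q} {m p} → HasPeriod s m → IsPeriodOf p s → m ∣ p
least-period-∣ {s = s} {m = m@(suc _)} {p} ((_ , m-periodic) , least) (_ , p-periodic)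
  with p % m in p%m≡r
... | zero  = m%n≡0⇒n∣m p m p%m≡r
... | suc r = contradiction (least (suc r) (s≤s z≤n , r-periodic))
                            (<⇒≱ (subst (_< m) p%m≡r (m%n<n p m)))
  where
  r-periodic : ∀ i → s (i + suc r) ≡ s i
  r-periodic i = begin
    s (i + suc r)                ≡⟨ periodic-+* m-periodic (i + suc r) (p / m) ⟨
    s (i + suc r + p / m * m)    ≡⟨ cong s (+-assoc i (suc r) (p / m * m)) ⟩
    s (i + (suc r + p / m * m))  ≡⟨ cong (λ x → s (i + (x + p / m * m))) p%m≡r ⟨
    s (i + (p % m + p / m * m))  ≡⟨ cong (λ x → s (i + x)) (m≡m%n+[m/n]*n p m) ⟨
    s (i + p)                    ≡⟨ p-periodic i ⟩
    s i                          ∎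

tabulate-∷ʳ : ∀ {A : Set} n (f : ℕ → A) → tabulate {n = suc n} (f ∘ toℕ) ≡ tabulate (f ∘ toℕ) ∷ʳ f n
tabulate-∷ʳ zero    f = refl
tabulate-∷ʳ (suc n) f = cong (f 0 ∷_) (tabulate-∷ʳ n (f ∘ suc))

reverse-tabulate : ∀ {A : Set} n (f : ℕ → A) →
                   reverse (tabulate {n = n} (f ∘ toℕ)) ≡ tabulate (λ t → f (n ∸ suc (toℕ t)))
reverse-tabulate zero    f = refl
reverse-tabulate (suc n) f = begin
  reverse (f 0 ∷ tabulate (f ∘ suc ∘ toℕ))             ≡⟨ reverse-∷ (f 0) (tabulate (f ∘ suc ∘ toℕ)) ⟩
  reverse (tabulate (f ∘ suc ∘ toℕ)) ∷ʳ f 0            ≡⟨ cong (_∷ʳ f 0) (reverse-tabulate n (f ∘ suc)) ⟩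
  tabulate (λ t → f (suc (n ∸ suc (toℕ t)))) ∷ʳ f 0    ≡⟨ cong₂ _∷ʳ_ (tabulate-cong λ t → cong f (+-∸-assoc 1 (toℕ<n t)))
                                                                    (cong f (n∸n≡0 n)) ⟨
  tabulate (λ t → f (n ∸ toℕ t)) ∷ʳ f (n ∸ n)          ≡⟨ tabulate-∷ʳ n (λ t → f (n ∸ t)) ⟨
  tabulate (λ t → f (n ∸ toℕ t))                       ∎

module _ {q : ℕ} where

  window-≡⇒ : ∀ {n} (u v : Seq q) i j → window n u i ≡ window n v j →
              ∀ {t} → t < n → u (i + t) ≡ v (j + t)
  window-≡⇒ {n} u v i j eq {t} t<n = begin
    u (i + t)                            ≡⟨ cong (λ x → u (i + x)) (toℕ-fromℕ< t<n) ⟨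
    u (i + toℕ (fromℕ< t<n))              ≡⟨ lookup∘tabulate _ (fromℕ< t<n) ⟨
    lookup (window n u i) (fromℕ< t<n)    ≡⟨ cong (λ w → lookup w (fromℕ< t<n)) eq ⟩
    lookup (window n v j) (fromℕ< t<n)    ≡⟨ lookup∘tabulate _ (fromℕ< t<n) ⟩
    v (j + toℕ (fromℕ< t<n))              ≡⟨ cong (λ x → v (j + x)) (toℕ-fromℕ< t<n) ⟩
    v (j + t)                            ∎

  pointwise⇒window-≡ : ∀ {n} (u v : Seq q) i j → (∀ {t} → t < n → u (i + t) ≡ v (j + t)) →
                       window n u i ≡ window n v j
  pointwise⇒window-≡ _ _ _ _ agree = tabulate-cong λ t → agree (toℕ<n t)

  window-cong : ∀ {n} {u v : Seq q} → (∀ i → u i ≡ v i) → ∀ i → window n u i ≡ window n v i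
  window-cong {u = u} {v} u≗v i = pointwise⇒window-≡ u v i i λ {t} _ → u≗v (i + t)

  window-head : ∀ {n} (u v : Seq q) i j → window (suc n) u i ≡ window (suc n) v j → u i ≡ v j
  window-head u v i j eq =
    subst₂ (λ a b → u a ≡ v b) (+-identityʳ i) (+-identityʳ j) (cong head eq)

module _ {q : ℕ} .{{_ : NonZero q}} where
  open Residues q using (-q-anticomm)

  window-D : ∀ {n} (u v : Seq q) i j → window (suc n) u i ≡ window (suc n) v j →
             window n (D u) i ≡ window n (D v) j
  window-D {n} u v i j eq = pointwise⇒window-≡ (D u) (D v) i j λ t<n →
    cong₂ _-q_ (next t<n) (window-≡⇒ u v i j eq (m<n⇒m<1+n t<n))
    where
    next : ∀ {t} → t < n → u (suc (i + t)) ≡ v (suc (j + t))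
    next {t} t<n = subst₂ (λ a b → u a ≡ v b) (+-suc i t) (+-suc j t) (window-≡⇒ u v i j eq (s≤s t<n))

  window-D-reverse : ∀ {n} (u v : Seq q) i j → window (suc n) u i ≡ reverse (window (suc n) v j) →
                     window n (D u) i ≡ negV (reverse (window n (D v) j))
  window-D-reverse {n} u v i j eq = begin
    window n (D u) i
      ≡⟨ pointwise⇒window-≡ (D u) (λ t → negq (D v (j + (n ∸ suc t)))) i 0 step ⟩
    tabulate (negq ∘ (λ t → D v (j + (n ∸ suc (toℕ t)))))  ≡⟨ tabulate-∘ negq _ ⟩
    negV (tabulate (λ t → D v (j + (n ∸ suc (toℕ t)))))    ≡⟨ cong negV (reverse-tabulate n (λ t → D v (j + t))) ⟨
    negV (reverse (window n (D v) j))                     ∎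
    where
    mirror : ∀ {t} → t < suc n → u (i + t) ≡ v (j + (n ∸ t))
    mirror = window-≡⇒ u (λ t → v (j + (n ∸ t))) i 0
                       (trans eq (reverse-tabulate (suc n) (λ t → v (j + t))))
    step : ∀ {t} → t < n → D u (i + t) ≡ negq (D v (j + (n ∸ suc t)))
    step {t} t<n = begin
      u (suc (i + t)) -q u (i + t)        ≡⟨ cong₂ _-q_ (trans (cong u (sym (+-suc i t))) (mirror (s≤s t<n)))
                                                        (mirror (m<n⇒m<1+n t<n)) ⟩
      v (j + r) -q v (j + (n ∸ t))        ≡⟨ cong (λ x → v (j + r) -q v x)
                                                   (trans (cong (j +_) (+-∸-assoc 1 t<n)) (+-suc j r)) ⟩
      v (j + r) -q v (suc (j + r))        ≡⟨ -q-anticomm _ _ ⟩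
      negq (D v (j + r))                  ∎
      where
      r : ℕ
      r = n ∸ suc t

module Integration {q : ℕ} .{{_ : NonZero q}} (s : Seq q) where
  open Residues q

  partialSum : ℕ → ℕ
  partialSum zero    = 0
  partialSum (suc i) = partialSum i + toℕ (s i)

  wq≡partialSum : ∀ k → wq s k ≡ partialSum k mod q
  wq≡partialSum zero    = refl
  wq≡partialSum (suc k) = begin
    wq s (suc k)                                 ≡⟨ +-mod _ (toℕ (s k)) ⟩
    wq s k +q (toℕ (s k) mod q)                  ≡⟨ cong (_+q (toℕ (s k) mod q)) (wq≡partialSum k) ⟩
    (partialSum k mod q) +q (toℕ (s k) mod q)    ≡⟨ +-mod (partialSum k) (toℕ (s k)) ⟨
    partialSum (suc k) mod q                     ∎

  integrate : ℕ → Seq q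
  integrate a i = (partialSum i + a) mod q

  integrate-suc : ∀ a i → integrate a (suc i) ≡ integrate a i +q s i
  integrate-suc a i = begin
    (partialSum i + toℕ (s i) + a) mod q           ≡⟨ cong (_mod q) (xy∙z≈xz∙y (partialSum i) (toℕ (s i)) a) ⟩
    (partialSum i + a + toℕ (s i)) mod q           ≡⟨ +-mod (partialSum i + a) (toℕ (s i)) ⟩
    integrate a i +q (toℕ (s i) mod q)             ≡⟨ cong (integrate a i +q_) (mod-toℕ (s i)) ⟩
    integrate a i +q s i                           ∎

  D-integrate : ∀ a i → D (integrate a) i ≡ s i
  D-integrate a i = ≡+q⇒-q≡ (integrate-suc a i)

  D≗⇒integrate : ∀ {u} → (∀ i → D u i ≡ s i) → ∀ i → u i ≡ integrate (toℕ (u 0)) i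
  D≗⇒integrate {u} Du≗s zero    = sym (mod-toℕ (u 0))
  D≗⇒integrate {u} Du≗s (suc i) = begin
    u (suc i)                          ≡⟨ -q≡⇒≡+q (Du≗s i) ⟩
    u i +q s i                         ≡⟨ cong (_+q s i) (D≗⇒integrate {u} Du≗s i) ⟩
    integrate (toℕ (u 0)) i +q s i     ≡⟨ integrate-suc (toℕ (u 0)) i ⟨
    integrate (toℕ (u 0)) (suc i)      ∎

  integrate-cong : ∀ {a b} → a mod q ≡ b mod q → ∀ i → integrate a i ≡ integrate b i
  integrate-cong eq i = +-congˡ-mod (partialSum i) eq

  integrate-injective : ∀ {a b} i → integrate a i ≡ integrate b i → a mod q ≡ b mod q
  integrate-injective {a} {b} i eq = ∙-cancelˡ (partialSum i mod q) (a mod q) (b mod q) (begin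
    (partialSum i mod q) +q (a mod q)   ≡⟨ +-mod (partialSum i) a ⟨
    integrate a i                       ≡⟨ eq ⟩
    integrate b i                       ≡⟨ +-mod (partialSum i) b ⟩
    (partialSum i mod q) +q (b mod q)   ∎)

  integrate-period⇒period : ∀ {a p} → (∀ i → integrate a (i + p) ≡ integrate a i) → ∀ i → s (i + p) ≡ s i
  integrate-period⇒period {a} {p} periodic i = begin
    s (i + p)                       ≡⟨ D-integrate a (i + p) ⟨
    D (integrate a) (i + p)         ≡⟨ cong₂ _-q_ (periodic (suc i)) (periodic i) ⟩
    D (integrate a) i               ≡⟨ D-integrate a i ⟩
    s i                             ∎

  window-integrate : ∀ {n} a b i j → window (suc n) (integrate a) i ≡ window (suc n) (integrate b) j →
                     window n s i ≡ window n s j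
  window-integrate {n} a b i j eq = begin
    window n s i                    ≡⟨ window-cong (D-integrate a) i ⟨
    window n (D (integrate a)) i    ≡⟨ window-D (integrate a) (integrate b) i j eq ⟩
    window n (D (integrate b)) j    ≡⟨ window-cong (D-integrate b) j ⟩
    window n s j                    ∎

  window-integrate-reverse : ∀ {n} a b i j →
    window (suc n) (integrate a) i ≡ reverse (window (suc n) (integrate b) j) →
    window n s i ≡ negV (reverse (window n s j))
  window-integrate-reverse {n} a b i j eq = begin
    window n s i                                    ≡⟨ window-cong (D-integrate a) i ⟨
    window n (D (integrate a)) i                    ≡⟨ window-D-reverse (integrate a) (integrate b) i j eq ⟩
    negV (reverse (window n (D (integrate b)) j))   ≡⟨ cong (negV ∘ reverse) (window-cong (D-integrate b) j) ⟩
    negV (reverse (window n s j))                   ∎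

  module _ {m} (s-periodic : ∀ i → s (i + m) ≡ s i) where

    partialSum-+ : ∀ i → partialSum (i + m) ≡ partialSum i + partialSum m
    partialSum-+ zero    = refl
    partialSum-+ (suc i) = begin
      partialSum (i + m) + toℕ (s (i + m))       ≡⟨ cong₂ (λ x y → x + toℕ y) (partialSum-+ i) (s-periodic i) ⟩
      partialSum i + partialSum m + toℕ (s i)    ≡⟨ xy∙z≈xz∙y (partialSum i) (partialSum m) (toℕ (s i)) ⟩
      partialSum (suc i) + partialSum m          ∎

    partialSum-+* : ∀ i k → partialSum (i + k * m) ≡ partialSum i + k * partialSum m
    partialSum-+* i zero    = trans (cong partialSum (+-identityʳ i)) (sym (+-identityʳ (partialSum i)))
    partialSum-+* i (suc k) = begin
      partialSum (i + (m + k * m))                      ≡⟨ cong partialSum (+-assoc i m (k * m)) ⟨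
      partialSum (i + m + k * m)                        ≡⟨ partialSum-+* (i + m) k ⟩
      partialSum (i + m) + k * partialSum m             ≡⟨ cong (_+ k * partialSum m) (partialSum-+ i) ⟩
      partialSum i + partialSum m + k * partialSum m    ≡⟨ +-assoc (partialSum i) (partialSum m) (k * partialSum m) ⟩
      partialSum i + suc k * partialSum m               ∎

    integrate-+* : ∀ a i k → integrate a (i + k * m) ≡ integrate (a + k * toℕ (wq s m)) i
    integrate-+* a i k = begin
      (partialSum (i + k * m) + a) mod q             ≡⟨ cong (λ x → (x + a) mod q) (partialSum-+* i k) ⟩
      (partialSum i + k * partialSum m + a) mod q    ≡⟨ cong (_mod q) (xy∙z≈x∙zy (partialSum i) (k * partialSum m) a) ⟩
      (partialSum i + (a + k * partialSum m)) mod q  ≡⟨ +-congˡ-mod (partialSum i) (+-congˡ-mod a (*-congˡ-mod k Σ≡w)) ⟩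
      (partialSum i + (a + k * toℕ (wq s m))) mod q  ∎
      where
      Σ≡w : partialSum m mod q ≡ toℕ (wq s m) mod q
      Σ≡w = trans (sym (wq≡partialSum m)) (sym (mod-toℕ (wq s m)))

gcd-multiple : ∀ a q .{{_ : NonZero q}} → ∃ λ c → gcd a q mod q ≡ (c * a) mod q
gcd-multiple a q with Bézout.identity (gcd-GCD a q)
... | Bézout.+- x y eq = x , (begin
  gcd a q mod q                ≡⟨ +-mod-∣ʳ (gcd a q) (n∣m*n y) ⟨
  (gcd a q + y * q) mod q      ≡⟨ cong (_mod q) eq ⟩
  (x * a) mod q                ∎)
  where open Residues q
-- Here gcd a q + x a ≡ 0 (mod q), so gcd a q ≡ (q - 1) x a.
... | Bézout.-+ x y eq = pred q * x , (begin
  gcd a q mod q                             ≡⟨ +-mod-∣ʳ (gcd a q) (n∣m*n (x * a)) ⟨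
  (gcd a q + x * a * q) mod q               ≡⟨ cong (λ r → (gcd a q + x * a * r) mod q) (suc-pred q) ⟨
  (gcd a q + x * a * suc (pred q)) mod q    ≡⟨ cong (_mod q) (split (gcd a q) x a (pred q)) ⟩
  (gcd a q + x * a + pred q * x * a) mod q  ≡⟨ cong (λ r → (r + pred q * x * a) mod q) eq ⟩
  (y * q + pred q * x * a) mod q            ≡⟨ +-mod-∣ˡ (pred q * x * a) (n∣m*n y) ⟩
  (pred q * x * a) mod q                    ∎)
  where
  open Residues q
  split : ∀ g x a p → g + x * a * suc p ≡ g + x * a + p * x * a
  split = solve-∀

module AdditiveOrder {q : ℕ} .{{_ : NonZero q}} {w h : ℕ}
  (1≤h : 1 ≤ h) (q∣h*w : q ∣ h * w) (minimal : ∀ h' → 1 ≤ h' → q ∣ h' * w → h ≤ h') where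
  open Residues q

  private instance
    h-nonZero : NonZero h
    h-nonZero = >-nonZero 1≤h

    gcd-nonZero : NonZero (gcd w q)
    gcd-nonZero = ≢-nonZero (gcd[m,n]≢0 w q (inj₂ (≢-nonZero⁻¹ q)))

  *-mod-reduce : ∀ k → (k * w) mod q ≡ (k % h * w) mod q
  *-mod-reduce k = begin
    (k * w) mod q                          ≡⟨ cong (λ x → (x * w) mod q) (m≡m%n+[m/n]*n k h) ⟩
    ((k % h + k / h * h) * w) mod q        ≡⟨ cong (_mod q) (distrib (k % h) (k / h) h w) ⟩
    (k % h * w + k / h * (h * w)) mod q    ≡⟨ +-mod-∣ʳ (k % h * w) (∣n⇒∣m*n (k / h) q∣h*w) ⟩
    (k % h * w) mod q                      ∎
    where
    distrib : ∀ r d h w → (r + d * h) * w ≡ r * w + d * (h * w)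
    distrib = solve-∀

  order-∣ : ∀ k → q ∣ k * w → h ∣ k
  order-∣ k q∣k*w with k % h in k%h≡r
  ... | zero  = m%n≡0⇒n∣m k h k%h≡r
  ... | suc r = contradiction (minimal (suc r) (s≤s z≤n) q∣r*w)
                              (<⇒≱ (subst (_< h) k%h≡r (m%n<n k h)))
    where
    q∣r*w : q ∣ suc r * w
    q∣r*w = mod≡0q⇒∣ (begin
      (suc r * w) mod q    ≡⟨ cong (λ x → (x * w) mod q) k%h≡r ⟨
      (k % h * w) mod q    ≡⟨ *-mod-reduce k ⟨
      (k * w) mod q        ≡⟨ ∣⇒mod≡0q q∣k*w ⟩
      0q                   ∎)

  gcd*order≡q : gcd w q * h ≡ q
  gcd*order≡q = ∣-antisym (subst (g * h ∣_) (m*[n/m]≡n g∣q) (*-monoʳ-∣ g h∣q/g))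
                          (subst (q ∣_) (*-comm h g) q∣h*g)
    where
    g : ℕ
    g = gcd w q

    g∣q : g ∣ q
    g∣q = gcd[m,n]∣n w q

    g∣w : g ∣ w
    g∣w = gcd[m,n]∣m w q

    h∣q/g : h ∣ q / g
    h∣q/g = order-∣ (q / g) (divides (w / g) (begin
      q / g * w                ≡⟨ cong (q / g *_) (m/n*n≡m g∣w) ⟨
      q / g * (w / g * g)      ≡⟨ rotate (q / g) (w / g) g ⟩
      w / g * (g * (q / g))    ≡⟨ cong (w / g *_) (m*[n/m]≡n g∣q) ⟩
      w / g * q                ∎))
      where
      rotate : ∀ x y z → x * (y * z) ≡ y * (z * x)
      rotate = solve-∀

    q∣h*g : q ∣ h * g
    q∣h*g with gcd-multiple w q
    ... | c , g≡c*w = mod≡0q⇒∣ (begin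
      (h * g) mod q          ≡⟨ *-congˡ-mod h g≡c*w ⟩
      (h * (c * w)) mod q    ≡⟨ cong (_mod q) (x*yz≡y*xz h c w) ⟩
      (c * (h * w)) mod q    ≡⟨ ∣⇒mod≡0q (∣n⇒∣m*n c q∣h*w) ⟩
      0q                     ∎)
      where
      x*yz≡y*xz : ∀ x y z → x * (y * z) ≡ y * (x * z)
      x*yz≡y*xz = solve-∀

  coset-decomposition : ∀ a → ∃ λ (ℓ : Fin (gcd w q)) → ∃ λ k → k < h × a mod q ≡ (toℕ ℓ + k * w) mod q
  coset-decomposition a with gcd-multiple w q
  ... | c , g≡c*w = a mod g , j % h , m%n<n j h , (begin
    a mod q                          ≡⟨ cong (_mod q) (m≡m%n+[m/n]*n a g) ⟩
    (a % g + a / g * g) mod q        ≡⟨ +-congˡ-mod (a % g) (*-congˡ-mod (a / g) g≡c*w) ⟩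
    (a % g + a / g * (c * w)) mod q  ≡⟨ cong (λ x → (a % g + x) mod q) (*-assoc (a / g) c w) ⟨
    (a % g + j * w) mod q            ≡⟨ +-congˡ-mod (a % g) (*-mod-reduce j) ⟩
    (a % g + j % h * w) mod q        ≡⟨ cong (λ x → (x + j % h * w) mod q) (toℕ-mod a g) ⟨
    (toℕ (a mod g) + j % h * w) mod q ∎)
    where
    g j : ℕ
    g = gcd w q
    j = a / g * c

  coset-representative-unique : ∀ {ℓ ℓ' : Fin (gcd w q)} k → (toℕ ℓ + k * w) mod q ≡ toℕ ℓ' mod q →
                                ℓ ≡ ℓ' × h ∣ k
  coset-representative-unique {ℓ} {ℓ'} k eq = ℓ≡ℓ' , order-∣ k (mod≡0q⇒∣ k*w≡0)
    where
    g : ℕ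
    g = gcd w q
    ℓ≡ℓ' : ℓ ≡ ℓ'
    ℓ≡ℓ' = toℕ-injective (begin
      toℕ ℓ                    ≡⟨ m<n⇒m%n≡m (toℕ<n ℓ) ⟨
      toℕ ℓ % g                ≡⟨ %-remove-+ʳ (toℕ ℓ) (∣n⇒∣m*n k (gcd[m,n]∣m w q)) ⟨
      (toℕ ℓ + k * w) % g      ≡⟨ m∣n⇒o%n%m≡o%m g q _ (gcd[m,n]∣n w q) ⟨
      (toℕ ℓ + k * w) % q % g  ≡⟨ cong (_% g) (mod≡mod⇒%≡% eq) ⟩
      toℕ ℓ' % q % g           ≡⟨ m∣n⇒o%n%m≡o%m g q _ (gcd[m,n]∣n w q) ⟩
      toℕ ℓ' % g               ≡⟨ m<n⇒m%n≡m (toℕ<n ℓ') ⟩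
      toℕ ℓ'                   ∎)
    k*w≡0 : (k * w) mod q ≡ 0q
    k*w≡0 = ∙-cancelˡ (toℕ ℓ mod q) _ _ (begin
      (toℕ ℓ mod q) +q ((k * w) mod q)  ≡⟨ +-mod (toℕ ℓ) (k * w) ⟨
      (toℕ ℓ + k * w) mod q             ≡⟨ eq ⟩
      toℕ ℓ' mod q                      ≡⟨ cong (λ x → toℕ x mod q) ℓ≡ℓ' ⟨
      toℕ ℓ mod q                       ≡⟨ +q-identityʳ (toℕ ℓ mod q) ⟨
      (toℕ ℓ mod q) +q 0q               ∎)

module Construction {q n m : ℕ} .{{_ : NonZero q}} {s : Seq q}
  (period : HasPeriod s m)
  (windows-distinct : ∀ i j → window n s i ≡ window n s j → i ≡ j [mod m ])
  (no-neg-reverse : ∀ i j → window n s i ≢ negV (reverse (window n s j)))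
  {h : ℕ} (1≤h : 1 ≤ h) (q∣h*w : q ∣ h * toℕ (wq s m))
  (minimal : ∀ h' → 1 ≤ h' → q ∣ h' * toℕ (wq s m) → h ≤ h')
  where
  open Residues q
  open Integration s
  open AdditiveOrder {w = toℕ (wq s m)} 1≤h q∣h*w minimal public

  private
    s-periodic : ∀ i → s (i + m) ≡ s i
    s-periodic = proj₂ (proj₁ period)

    1≤h*m : 1 ≤ h * m
    1≤h*m = *-mono-≤ 1≤h (proj₁ (proj₁ period))

  T : Fin (gcd (toℕ (wq s m)) q) → Seq q
  T ℓ = integrate (toℕ ℓ)

  T-shift : ∀ ℓ i k → T ℓ (i + k * m) ≡ integrate (toℕ ℓ + k * toℕ (wq s m)) i
  T-shift ℓ = integrate-+* s-periodic (toℕ ℓ)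

  T-periodic : ∀ ℓ i → T ℓ (i + h * m) ≡ T ℓ i
  T-periodic ℓ i = trans (T-shift ℓ i h) (integrate-cong (+-mod-∣ʳ (toℕ ℓ) q∣h*w) i)

  shift-coincidence : ∀ {ℓ ℓ'} j k → T ℓ (j + k * m) ≡ T ℓ' j → ℓ ≡ ℓ' × h ∣ k
  shift-coincidence {ℓ} j k eq =
    coset-representative-unique k (integrate-injective j (trans (sym (T-shift ℓ j k)) eq))

  window-coincidence : ∀ {ℓ ℓ'} i j → window (suc n) (T ℓ) i ≡ window (suc n) (T ℓ') j →
                       ℓ ≡ ℓ' × (i ≡ j [mod h * m ])
  window-coincidence {ℓ} {ℓ'} i j eq
    with windows-distinct i j (window-integrate (toℕ ℓ) (toℕ ℓ') i j eq)
  ... | k , inj₁ refl with shift-coincidence j k (window-head (T ℓ) (T ℓ') (j + k * m) j eq)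
  ...   | ℓ≡ℓ' , divides k′ refl = ℓ≡ℓ' , k′ , inj₁ (cong (j +_) (*-assoc k′ h m))
  window-coincidence {ℓ} {ℓ'} i j eq
      | k , inj₂ refl with shift-coincidence i k (sym (window-head (T ℓ) (T ℓ') i (i + k * m) eq))
  ...   | ℓ'≡ℓ , divides k′ refl = sym ℓ'≡ℓ , k′ , inj₂ (cong (i +_) (*-assoc k′ h m))

  T-window≢reverse : ∀ ℓ ℓ' i j → window (suc n) (T ℓ) i ≢ reverse (window (suc n) (T ℓ') j)
  T-window≢reverse ℓ ℓ' i j eq = no-neg-reverse i j (window-integrate-reverse (toℕ ℓ) (toℕ ℓ') i j eq)

  T-least-period : ∀ ℓ p → IsPeriodOf p (T ℓ) → h * m ≤ p
  T-least-period ℓ p (1≤p , T-p-periodic)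
    with least-period-∣ period (1≤p , integrate-period⇒period T-p-periodic)
  ... | divides zero    refl = contradiction 1≤p λ ()
  ... | divides (suc j) refl = *-monoˡ-≤ m (∣⇒≤ (proj₂ (shift-coincidence 0 (suc j) (T-p-periodic 0))))

  T-orientable : ∀ ℓ → Orientable (suc n) (T ℓ) (h * m)
  T-orientable ℓ =
    (((1≤h*m , T-periodic ℓ) , T-least-period ℓ) , λ i j eq → proj₂ (window-coincidence {ℓ} {ℓ} i j eq)) ,
    T-window≢reverse ℓ ℓ

  T-translate : ∀ {ℓ ℓ'} → ℓ ≢ ℓ' → IsTranslate (T ℓ') (T ℓ)
  T-translate {ℓ} {ℓ'} ℓ≢ℓ' = c , c≢0 , translated
    where
    [ℓ] [ℓ'] c : Fin q
    [ℓ]  = toℕ ℓ mod q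
    [ℓ'] = toℕ ℓ' mod q
    c    = [ℓ'] -q [ℓ]

    c≢0 : c ≢ 0q
    c≢0 c≡0 = ℓ≢ℓ' (toℕ-injective (mod-injective (toℕ<q ℓ) (toℕ<q ℓ') (sym (x∙y⁻¹≈ε⇒x≈y [ℓ'] [ℓ] c≡0))))
      where
      toℕ<q : (x : Fin (gcd (toℕ (wq s m)) q)) → toℕ x < q
      toℕ<q x = <-≤-trans (toℕ<n x) (gcd[m,n]≤n (toℕ (wq s m)) q)

    translated : ∀ i → T ℓ' i ≡ T ℓ i +q c
    translated i = begin
      T ℓ' i                                     ≡⟨ +-mod (partialSum i) (toℕ ℓ') ⟩
      (partialSum i mod q) +q [ℓ']               ≡⟨ cong ((partialSum i mod q) +q_) (//-rightDividesˡ [ℓ] [ℓ']) ⟨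
      (partialSum i mod q) +q (c +q [ℓ])         ≡⟨ cong ((partialSum i mod q) +q_) (+q-comm c [ℓ]) ⟩
      (partialSum i mod q) +q ([ℓ] +q c)         ≡⟨ +q-assoc (partialSum i mod q) [ℓ] c ⟨
      ((partialSum i mod q) +q [ℓ]) +q c         ≡⟨ cong (_+q c) (+-mod (partialSum i) (toℕ ℓ)) ⟨
      T ℓ i +q c                                 ∎

  T-oDisjoint : ∀ {ℓ ℓ'} → ℓ ≢ ℓ' → ODisjoint (suc n) (T ℓ) (T ℓ')
  T-oDisjoint {ℓ} {ℓ'} ℓ≢ℓ' =
    (λ i j eq → ℓ≢ℓ' (proj₁ (window-coincidence {ℓ} {ℓ'} i j eq))) , T-window≢reverse ℓ ℓ'

  ShiftOfT : Seq q → Set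
  ShiftOfT u = ∃ λ ℓ → Σ ℕ λ k → k < h × (∀ i → u i ≡ T ℓ (i + k * m))

  D⁻¹⇒ShiftOfT : ∀ u → InDInv s u → ShiftOfT u
  D⁻¹⇒ShiftOfT u (_ , Du≗s) = shift (coset-decomposition (toℕ (u 0)))
    where
    shift : (∃ λ ℓ → ∃ λ k → k < h × toℕ (u 0) mod q ≡ (toℕ ℓ + k * toℕ (wq s m)) mod q) → ShiftOfT u
    shift (ℓ , k , k<h , u₀≡ℓ+kw) = ℓ , k , k<h , λ i → begin
      u i                                        ≡⟨ D≗⇒integrate {u} Du≗s i ⟩
      integrate (toℕ (u 0)) i                    ≡⟨ integrate-cong u₀≡ℓ+kw i ⟩
      integrate (toℕ ℓ + k * toℕ (wq s m)) i     ≡⟨ T-shift ℓ i k ⟨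
      T ℓ (i + k * m)                            ∎

  ShiftOfT⇒D⁻¹ : ∀ u → ShiftOfT u → InDInv s u
  ShiftOfT⇒D⁻¹ u (ℓ , k , _ , u≗) = (h * m , 1≤h*m , u-periodic) , Du≗s
    where
    u-periodic : ∀ i → u (i + h * m) ≡ u i
    u-periodic i = begin
      u (i + h * m)                ≡⟨ u≗ (i + h * m) ⟩
      T ℓ (i + h * m + k * m)      ≡⟨ cong (T ℓ) (xy∙z≈xz∙y i (h * m) (k * m)) ⟩
      T ℓ (i + k * m + h * m)      ≡⟨ T-periodic ℓ (i + k * m) ⟩
      T ℓ (i + k * m)              ≡⟨ u≗ i ⟨
      u i                          ∎
    Du≗s : ∀ i → D u i ≡ s i
    Du≗s i = begin
      D u i                 ≡⟨ cong₂ _-q_ (u≗ (suc i)) (u≗ i) ⟩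
      D (T ℓ) (i + k * m)   ≡⟨ D-integrate (toℕ ℓ) (i + k * m) ⟩
      s (i + k * m)         ≡⟨ periodic-+* s-periodic i k ⟩
      s i                   ∎

theorem6 : (q n m : ℕ) .{{_ : NonZero q}} → 2 ≤ q → 1 ≤ n →
    (s : Seq q) → NegOrientable n s m →
    (h : ℕ) → AddOrder (wq s m) h →
    Σ ℕ λ N → N * h ≡ q × Σ (Fin N → Seq q) λ T →
      (∀ ℓ → Orientable (1 + n) (T ℓ) (h * m)) ×
      (∀ ℓ ℓ' → ℓ ≢ ℓ' → IsTranslate (T ℓ') (T ℓ) × ODisjoint (1 + n) (T ℓ) (T ℓ')) ×
      (∀ u → InDInv s u ⇔ (∃ λ ℓ → Σ ℕ λ k → k < h × (∀ i → u i ≡ T ℓ (i + k * m))))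
theorem6 q n m _ _ s ((period , windows-distinct) , no-neg-reverse) h (1≤h , q∣h*w , minimal) =
  gcd (toℕ (wq s m)) q , gcd*order≡q , T , T-orientable ,
  (λ _ _ ℓ≢ℓ' → T-translate ℓ≢ℓ' , T-oDisjoint ℓ≢ℓ') ,
  λ u → mk⇔ (D⁻¹⇒ShiftOfT u) (ShiftOfT⇒D⁻¹ u)
  where open Construction period windows-distinct no-neg-reverse 1≤h q∣h*w minimal
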